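{- Let $X$ be a non-empty set, let $\sim$ be an equivalence relation on $\operatorname{Div}(X)$ satisfying (E1) and (E2), let $g\ge 0$ be an integer, and let $K\in\operatorname{Div}(X)$ have degree $2g-2$. Define $\epsilon:\operatorname{Div}(X)\to\mathbb{Z}/2\mathbb{Z}$ by $\epsilon(D)=0$ if $|D|\neq\emptyset$ and $\epsilon(D)=1$ if $|D|=\emptyset$. Then the formula \[ r(D)-r(K-D)=\deg(D)+1-g \] holds for all $D\in\operatorname{Div}(X)$ if and only if both of the following hold: (RR1) for every $D\in\operatorname{Div}(X)$ there exists $\nu\in\mathcal{N}$ with $\epsilon(D)+\epsilon(\nu-D)=1$; (RR2) for every $D\in\operatorname{Div}(X)$ with $\deg(D)=g-1$, $\epsilon(D)+\epsilon(K-D)=0$.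
   Context: $\operatorname{Div}(X)$ is the free abelian group on the set $X$; elements $D=\sum_x D(x)(x)$ (finitely many nonzero), $D\ge 0$ (effective) iff all coefficients are $\ge 0$, $\deg(D)=\sum_x D(x)$. The equivalence relation satisfies: (E1) if $D\sim D'$ then $\deg(D)=\deg(D')$; (E2) if $D_1\sim D_1'$ and $D_2\sim D_2'$ then $D_1+D_2\sim D_1'+D_2'$. $|D|=\{E\in\operatorname{Div}(X): E\ge 0,\ E\sim D\}$. $r(D)\in\{ -1,0,1,\dots\}$ is defined by: for each integer $s\ge 0$, $r(D)\ge s$ iff $|D-E|\ne\emptyset$ for all effective $E$ of degree $s$ (and $r(D)=-1$ if $|D|=\emptyset$). $\mathcal{N}=\{D\in\operatorname{Div}(X):\deg(D)=g-1,\ |D|=\emptyset\}$. -}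

module Defs where

open import Level using (Level; _⊔_)
open import Data.Nat using (ℕ)
open import Data.Integer using (ℤ; +_; -_; _+_; _-_; _≤_)
open import Data.Bool using (Bool; true; false; not; _xor_)
open import Data.List using (List; []; _++_; map; foldr; deduplicate)
open import Data.List.Membership.Propositional using (_∈_; _∉_)
open import Data.List.Membership.Propositional.Properties using (∈-++⁺ˡ; ∈-++⁺ʳ)
open import Data.Product using (Σ; ∃; _×_; _,_)
open import Function.Bundles using (_⇔_)
open import Relation.Nullary using (¬_; Dec; does)
open import Relation.Binary.Definitions using (DecidableEquality)
open import Relation.Binary.Structures using (IsEquivalence)
open import Relation.Binary.PropositionalEquality using (_≡_; refl; cong; cong₂)
open import Axiom.ExcludedMiddle using (ExcludedMiddle)

private
  variable
    a ℓ : Level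

-- Two divisors are the same element of Div(X) iff their coefficients agree
-- pointwise (relation _≐_ below).
record Div (X : Set a) : Set a where
  constructor mkDiv
  field
    coeff  : X → ℤ
    supp   : List X
    finite : ∀ x → x ∉ supp → coeff x ≡ + 0

open Div public

module _ {X : Set a} where

  _≐_ : Div X → Div X → Set a
  D ≐ E = ∀ x → coeff D x ≡ coeff E x

  _⊕_ : Div X → Div X → Div X
  D ⊕ E = mkDiv (λ x → coeff D x + coeff E x) (supp D ++ supp E)
    (λ x x∉ → cong₂ _+_ (finite D x (λ x∈ → x∉ (∈-++⁺ˡ x∈)))
                        (finite E x (λ x∈ → x∉ (∈-++⁺ʳ (supp D) x∈))))

  ⊝_ : Div X → Div X
  ⊝ D = mkDiv (λ x → - coeff D x) (supp D) (λ x x∉ → cong -_ (finite D x x∉))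

  _⊖_ : Div X → Div X → Div X
  D ⊖ E = D ⊕ (⊝ E)

  Effective : Div X → Set a
  Effective D = ∀ x → + 0 ≤ coeff D x

  deg : DecidableEquality X → Div X → ℤ
  deg _≟_ D = foldr _+_ (+ 0) (map (coeff D) (deduplicate _≟_ (supp D)))

  record IsDivEquivalence (_≟_ : DecidableEquality X)
                          (_∼_ : Div X → Div X → Set ℓ) : Set (a ⊔ ℓ) where
    field
      isEquivalence : IsEquivalence _∼_
      -- ∼ is a relation on Div(X), i.e. equal divisors are related
      respects-≐    : ∀ {D D′} → D ≐ D′ → D ∼ D′
      E1 : ∀ {D D′} → D ∼ D′ → deg _≟_ D ≡ deg _≟_ D′
      E2 : ∀ {D₁ D₁′ D₂ D₂′} → D₁ ∼ D₁′ → D₂ ∼ D₂′ → (D₁ ⊕ D₂) ∼ (D₁′ ⊕ D₂′)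

  module _ (_∼_ : Div X → Div X → Set ℓ) where

    _∈∣_∣ : Div X → Div X → Set (a ⊔ ℓ)
    E ∈∣ D ∣ = Effective E × E ∼ D

    NonemptyLS : Div X → Set (a ⊔ ℓ)
    NonemptyLS D = ∃ λ E → E ∈∣ D ∣

    EmptyLS : Div X → Set (a ⊔ ℓ)
    EmptyLS D = ¬ NonemptyLS D

    IsRank : DecidableEquality X → Div X → ℤ → Set (a ⊔ ℓ)
    IsRank _≟_ D r =
      (- (+ 1) ≤ r) ×
      (∀ (s : ℕ) → (+ s ≤ r) ⇔
         (∀ E → Effective E → deg _≟_ E ≡ + s → NonemptyLS (D ⊖ E)))

    InN : DecidableEquality X → ℕ → Div X → Set (a ⊔ ℓ)
    InN _≟_ g ν = (deg _≟_ ν ≡ + g - + 1) × EmptyLS ν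

    -- ε : Div(X) → ℤ/2ℤ, with ℤ/2ℤ modelled as (Bool, xor), false = 0, true = 1
    ε : ExcludedMiddle (a ⊔ ℓ) → Div X → Bool
    ε em D = not (does (em {NonemptyLS D}))

-- Under (RR1) the rank is computed by 𝒩.  If D − ν ∼ E − F with ν ∈ 𝒩 and E, F
-- effective, then r(D) < deg E, for an H ∈ |D − E| would put H + F in |ν|; and
-- the bound is attained: pick E effective of degree r(D) + 1 with |D − E| = ∅,
-- and (RR1) applied to D − E yields ν ∈ 𝒩 and F ∈ |ν − D + E|.  By (RR2),
-- K − ν ∈ 𝒩 as well, and (K − D) − (K − ν) ∼ F − E, so
-- r(K − D) < deg F = r(D) + 1 − deg D + (g − 1); this is the inequality
-- r(D) − r(K − D) ≥ deg D + 1 − g, and exchanging D with K − D gives equality.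
-- Conversely, the formula gives r(D) = r(K − D) when deg D = g − 1, i.e. (RR2).
-- If |D| = ∅ it gives r(K − D) = g − 2 − deg D, so some effective E of degree
-- g − 1 − deg D has |K − D − E| = ∅; then D + E has degree g − 1 and rank
-- r(K − D − E) = −1, so D + E ∈ 𝒩 lies above D, which is (RR1) for D.  If
-- |D| ≠ ∅, any ν ∈ 𝒩 has |ν − D| = ∅, and 𝒩 ≠ ∅ by the case D = −(x₀).

module Submission where

open import Defs
open import Level using (Level; _⊔_)
open import Data.Nat using (ℕ; zero; suc; z≤n; _*_)
open import Data.Integer
  using (ℤ; +_; -[1+_]; 0ℤ; 1ℤ; -1ℤ; -_; _+_; _-_; _≤_; _<_; ∣_∣; pred; +≤+; -≤-; +<+; -<+)
  renaming (suc to sucℤ)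
open import Data.Bool using (true; false; not; _xor_; if_then_else_)
open import Data.Product using (∃; _×_; _,_; proj₁; proj₂)
open import Function.Bundles using (_⇔_; mk⇔; Equivalence)
open import Relation.Binary.Definitions using (DecidableEquality)
open import Relation.Binary.PropositionalEquality
  using (_≡_; _≢_; refl; sym; trans; cong; cong₂; subst; setoid; module ≡-Reasoning)
open import Axiom.ExcludedMiddle using (ExcludedMiddle)

import Data.Nat as ℕ
import Data.Nat.Properties as ℕ
import Data.Integer as ℤ
import Data.Integer.Properties as ℤ
open import Data.Integer.Tactic.RingSolver using (solve-∀)
open import Data.Bool.Properties using (not-injective; not-involutive; xor-same)
open import Data.Empty using (⊥-elim)
open import Data.Sum using (_⊎_; inj₁; inj₂)
open import Data.List using (List; []; _∷_; _++_; map; foldr; filter; deduplicate)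
open import Data.List.Relation.Unary.Any using (here; there)
open import Data.List.Relation.Unary.All using ([])
open import Data.List.Relation.Unary.AllPairs using ([]; _∷_)
open import Data.List.Relation.Unary.Unique.Propositional using (Unique)
open import Data.List.Relation.Unary.Unique.Propositional.Properties using (filter⁺)
open import Data.List.Relation.Unary.Unique.DecPropositional.Properties using (deduplicate-!)
open import Data.List.Membership.Propositional using (_∈_; _∉_)
open import Data.List.Membership.Propositional.Properties
  using (∈-++⁺ˡ; ∈-++⁺ʳ; ∈-deduplicate⁺; ∈-filter⁺; ∈-filter⁻)
open import Data.List.Membership.Propositional.Properties.WithK using (unique∧set⇒bag)
import Data.List.Membership.DecPropositional as DecMembership
open import Data.List.Relation.Binary.Subset.Propositional using (_⊆_)
open import Data.List.Relation.Binary.BagAndSetEquality using (∼bag⇒↭)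
open import Data.List.Relation.Binary.Permutation.Propositional using (_↭_; ↭⇒↭ₛ)
import Data.List.Relation.Binary.Permutation.Propositional.Properties as ↭
open import Data.List.Relation.Binary.Permutation.Setoid.Properties using (foldr-commMonoid)
open import Function using (id; _∘_)
open import Function.Construct.Composition using (_⇔-∘_)
open import Function.Construct.Symmetry using (⇔-sym)
open import Relation.Nullary using (¬_; yes; no; does; ¬?; contradiction)
open import Relation.Nullary.Decidable using (dec-true; decidable-stable)
open import Relation.Unary using (Decidable)
open import Relation.Binary.Bundles using (Setoid)
open import Relation.Binary.Structures using (IsEquivalence)
import Relation.Binary.Reasoning.Setoid as SetoidReasoning

module Divisors {a} {X : Set a} (_≟_ : DecidableEquality X) where

  open DecMembership _≟_ using (_∈?_)

  sumOver : List X → (X → ℤ) → ℤ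
  sumOver L f = foldr _+_ 0ℤ (map f L)

  Supports : List X → (X → ℤ) → Set a
  Supports L f = ∀ x → x ∉ L → f x ≡ 0ℤ

  degree : Div X → ℤ
  degree = deg _≟_

  Supports-⊆ : ∀ {L M f} → L ⊆ M → Supports L f → Supports M f
  Supports-⊆ L⊆M L-supports x x∉M = L-supports x (x∉M ∘ L⊆M)

  sumOver-+ : ∀ L (f h : X → ℤ) → sumOver L (λ x → f x + h x) ≡ sumOver L f + sumOver L h
  sumOver-+ []      f h = refl
  sumOver-+ (y ∷ L) f h = trans (cong (_+_ (f y + h y)) (sumOver-+ L f h))
                                (interchange (f y) (h y) (sumOver L f) (sumOver L h))
    where
      interchange : ∀ a b c d → a + b + (c + d) ≡ a + c + (b + d)
      interchange = solve-∀

  sumOver-neg : ∀ L (f : X → ℤ) → sumOver L (λ x → - f x) ≡ - sumOver L f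
  sumOver-neg []      f = refl
  sumOver-neg (y ∷ L) f =
    trans (cong (_+_ (- f y)) (sumOver-neg L f)) (sym (ℤ.neg-distrib-+ (f y) _))

  sumOver-↭ : ∀ {L M} (f : X → ℤ) → L ↭ M → sumOver L f ≡ sumOver M f
  sumOver-↭ f L↭M =
    foldr-commMonoid (setoid ℤ) ℤ.+-0-isCommutativeMonoid (↭⇒↭ₛ (↭.map⁺ f L↭M))

  nonzero? : (f : X → ℤ) → Decidable (λ x → f x ≢ 0ℤ)
  nonzero? f x = ¬? (f x ℤ.≟ 0ℤ)

  nonzeros : (X → ℤ) → List X → List X
  nonzeros f = filter (nonzero? f)

  sumOver-nonzeros : ∀ L (f : X → ℤ) → sumOver (nonzeros f L) f ≡ sumOver L f
  sumOver-nonzeros []      f = refl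
  sumOver-nonzeros (y ∷ L) f with f y ℤ.≟ 0ℤ
  ... | yes fy≡0 = begin
    sumOver (nonzeros f L) f  ≡⟨ sumOver-nonzeros L f ⟩
    sumOver L f               ≡⟨ ℤ.+-identityˡ (sumOver L f) ⟨
    0ℤ + sumOver L f          ≡⟨ cong (_+ sumOver L f) fy≡0 ⟨
    f y + sumOver L f         ∎
    where open ≡-Reasoning
  ... | no  _    = cong (_+_ (f y)) (sumOver-nonzeros L f)

  ∈-nonzeros⇔ : ∀ {L f x} → Supports L f → x ∈ nonzeros f L ⇔ f x ≢ 0ℤ
  ∈-nonzeros⇔ {L} {f} {x} L-supports = mk⇔
    (λ x∈ → proj₂ (∈-filter⁻ (nonzero? f) {xs = L} x∈))
    (λ fx≢0 → ∈-filter⁺ (nonzero? f) (decidable-stable (x ∈? L) (fx≢0 ∘ L-supports x))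
                                      fx≢0)

  sumOver-unique : ∀ {L M f} → Unique L → Unique M → Supports L f → Supports M f →
                   sumOver L f ≡ sumOver M f
  sumOver-unique {L} {M} {f} L! M! L-supports M-supports = begin
    sumOver L f               ≡⟨ sumOver-nonzeros L f ⟨
    sumOver (nonzeros f L) f  ≡⟨ sumOver-↭ f (∼bag⇒↭ (unique∧set⇒bag L′! M′! same-elements)) ⟩
    sumOver (nonzeros f M) f  ≡⟨ sumOver-nonzeros M f ⟩
    sumOver M f               ∎
    where
      open ≡-Reasoning
      L′! : Unique (nonzeros f L)
      L′! = filter⁺ (nonzero? f) L!
      M′! : Unique (nonzeros f M)
      M′! = filter⁺ (nonzero? f) M!
      same-elements : ∀ {x} → x ∈ nonzeros f L ⇔ x ∈ nonzeros f M
      same-elements = ⇔-sym (∈-nonzeros⇔ M-supports) ⇔-∘ ∈-nonzeros⇔ L-supports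

  degree-sumOver : ∀ D {L} → Unique L → Supports L (coeff D) →
                   degree D ≡ sumOver L (coeff D)
  degree-sumOver D L! L-supports = sumOver-unique (deduplicate-! _≟_ (supp D)) L!
    (Supports-⊆ (∈-deduplicate⁺ _≟_) (finite D)) L-supports

  degree-⊕ : ∀ D E → degree (D ⊕ E) ≡ degree D + degree E
  degree-⊕ D E = begin
    degree (D ⊕ E)                             ≡⟨ sumOver-+ L (coeff D) (coeff E) ⟩
    sumOver L (coeff D) + sumOver L (coeff E)  ≡⟨ cong₂ _+_ (degree-sumOver D L! L-supports-D)
                                                            (degree-sumOver E L! L-supports-E) ⟨
    degree D + degree E                        ∎
    where
      open ≡-Reasoning
      L : List X
      L = deduplicate _≟_ (supp D ++ supp E)
      L! : Unique L
      L! = deduplicate-! _≟_ (supp D ++ supp E)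
      L-supports-D : Supports L (coeff D)
      L-supports-D = Supports-⊆ (∈-deduplicate⁺ _≟_ ∘ ∈-++⁺ˡ) (finite D)
      L-supports-E : Supports L (coeff E)
      L-supports-E = Supports-⊆ (∈-deduplicate⁺ _≟_ ∘ ∈-++⁺ʳ (supp D)) (finite E)

  degree-⊝ : ∀ D → degree (⊝ D) ≡ - degree D
  degree-⊝ D = sumOver-neg (deduplicate _≟_ (supp D)) (coeff D)

  degree-⊖ : ∀ D E → degree (D ⊖ E) ≡ degree D - degree E
  degree-⊖ D E = trans (degree-⊕ D (⊝ E)) (cong (_+_ (degree D)) (degree-⊝ E))

  sumOver-nonneg : ∀ L {f : X → ℤ} → (∀ x → 0ℤ ≤ f x) → 0ℤ ≤ sumOver L f
  sumOver-nonneg []      f≥0 = ℤ.≤-refl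
  sumOver-nonneg (y ∷ L) f≥0 = ℤ.+-mono-≤ (f≥0 y) (sumOver-nonneg L f≥0)

  term≤sumOver : ∀ {L} {f : X → ℤ} {x} → (∀ x → 0ℤ ≤ f x) → x ∈ L → f x ≤ sumOver L f
  term≤sumOver {y ∷ L} {f} f≥0 (here refl) = begin
    f y                ≡⟨ ℤ.+-identityʳ (f y) ⟨
    f y + 0ℤ           ≤⟨ ℤ.+-monoʳ-≤ (f y) (sumOver-nonneg L f≥0) ⟩
    f y + sumOver L f  ∎
    where open ℤ.≤-Reasoning
  term≤sumOver {y ∷ L} {f} {x} f≥0 (there x∈L) = begin
    f x                ≡⟨ ℤ.+-identityˡ (f x) ⟨
    0ℤ + f x           ≤⟨ ℤ.+-mono-≤ (f≥0 y) (term≤sumOver f≥0 x∈L) ⟩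
    f y + sumOver L f  ∎
    where open ℤ.≤-Reasoning

  ⊕-effective : ∀ {A B : Div X} → Effective A → Effective B → Effective (A ⊕ B)
  ⊕-effective A≥0 B≥0 x = ℤ.+-mono-≤ (A≥0 x) (B≥0 x)

  degree-nonneg : ∀ E → Effective E → 0ℤ ≤ degree E
  degree-nonneg E E≥0 = sumOver-nonneg (deduplicate _≟_ (supp E)) E≥0

  effective-degree-0 : ∀ E → Effective E → degree E ≡ 0ℤ → ∀ x → coeff E x ≡ 0ℤ
  effective-degree-0 E E≥0 deg≡0 x with x ∈? supp E
  ... | yes x∈ = ℤ.≤-antisym
    (subst (coeff E x ≤_) deg≡0 (term≤sumOver E≥0 (∈-deduplicate⁺ _≟_ x∈))) (E≥0 x)
  ... | no  x∉ = finite E x x∉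

  0D : Div X
  0D = mkDiv (λ _ → 0ℤ) [] (λ _ _ → refl)

  infix 25 _·⟨_⟩
  _·⟨_⟩ : ℕ → X → Div X
  n ·⟨ y ⟩ = mkDiv (λ x → if does (x ≟ y) then + n else 0ℤ) (y ∷ []) outside
    where
      outside : ∀ x → x ∉ y ∷ [] → (if does (x ≟ y) then + n else 0ℤ) ≡ 0ℤ
      outside x x∉ with x ≟ y
      ... | yes refl = ⊥-elim (x∉ (here refl))
      ... | no  _    = refl

  ·⟨⟩-effective : ∀ n y → Effective (n ·⟨ y ⟩)
  ·⟨⟩-effective n y x with x ≟ y
  ... | yes _ = +≤+ z≤n
  ... | no  _ = +≤+ z≤n

  degree-·⟨⟩ : ∀ n y → degree (n ·⟨ y ⟩) ≡ + n
  degree-·⟨⟩ n y = begin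
    degree (n ·⟨ y ⟩)                        ≡⟨ degree-sumOver (n ·⟨ y ⟩) ([] ∷ []) (finite (n ·⟨ y ⟩)) ⟩
    (if does (y ≟ y) then + n else 0ℤ) + 0ℤ  ≡⟨ cong (λ b → (if b then + n else 0ℤ) + 0ℤ) y≟y ⟩
    + n + 0ℤ                                 ≡⟨ ℤ.+-identityʳ (+ n) ⟩
    + n                                      ∎
    where
      open ≡-Reasoning
      y≟y : does (y ≟ y) ≡ true
      y≟y = dec-true (y ≟ y) refl

module LinearSystems {a ℓ} {X : Set a} {_≟_ : DecidableEquality X}
  {_∼_ : Div X → Div X → Set ℓ} (isDivEquivalence : IsDivEquivalence _≟_ _∼_) where

  open Divisors _≟_
  open IsDivEquivalence isDivEquivalence public
  open IsEquivalence isEquivalence public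
    renaming (refl to ∼-refl; sym to ∼-sym; trans to ∼-trans)

  ∼-setoid : Setoid a ℓ
  ∼-setoid = record { isEquivalence = isEquivalence }

  open SetoidReasoning ∼-setoid

  Nonempty : Div X → Set (a ⊔ ℓ)
  Nonempty = NonemptyLS _∼_

  Empty : Div X → Set (a ⊔ ℓ)
  Empty = EmptyLS _∼_

  ⊕-congˡ : ∀ {A A′} C → A ∼ A′ → (A ⊕ C) ∼ (A′ ⊕ C)
  ⊕-congˡ C A∼A′ = E2 A∼A′ (∼-refl {C})

  ⊕-congʳ : ∀ C {B B′} → B ∼ B′ → (C ⊕ B) ∼ (C ⊕ B′)
  ⊕-congʳ C B∼B′ = E2 (∼-refl {C}) B∼B′

  ⊝-cong : ∀ {A B} → A ∼ B → (⊝ A) ∼ (⊝ B)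
  ⊝-cong {A} {B} A∼B = begin
    ⊝ A                  ≈⟨ respects-≐ (λ x → insert (coeff A x) (coeff B x)) ⟩
    ((⊝ A) ⊕ B) ⊕ (⊝ B)  ≈⟨ ⊕-congˡ (⊝ B) (⊕-congʳ (⊝ A) (∼-sym A∼B)) ⟩
    ((⊝ A) ⊕ A) ⊕ (⊝ B)  ≈⟨ respects-≐ (λ x → cancel (coeff A x) (coeff B x)) ⟩
    ⊝ B                  ∎
    where
      insert : ∀ a b → - a ≡ (- a + b) + - b
      insert = solve-∀
      cancel : ∀ a b → (- a + a) + - b ≡ - b
      cancel = solve-∀

  ⊖-congʳ : ∀ A {B B′} → B ∼ B′ → (A ⊖ B) ∼ (A ⊖ B′)
  ⊖-congʳ A B∼B′ = ⊕-congʳ A (⊝-cong B∼B′)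

  ⊖-dual : ∀ K {D D′ ν E F} → D′ ∼ (K ⊖ D) → (D ⊖ ν) ∼ (E ⊖ F) →
           (D′ ⊖ (K ⊖ ν)) ∼ (F ⊖ E)
  ⊖-dual K {D} {D′} {ν} {E} {F} D′∼K-D D-ν∼E-F = begin
    D′ ⊖ (K ⊖ ν)        ≈⟨ ⊕-congˡ (⊝ (K ⊖ ν)) D′∼K-D ⟩
    (K ⊖ D) ⊖ (K ⊖ ν)   ≈⟨ respects-≐ (λ x → cancel (coeff K x) (coeff D x) (coeff ν x)) ⟩
    ⊝ (D ⊖ ν)           ≈⟨ ⊝-cong D-ν∼E-F ⟩
    ⊝ (E ⊖ F)           ≈⟨ respects-≐ (λ x → swap (coeff E x) (coeff F x)) ⟩
    F ⊖ E               ∎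
    where
      cancel : ∀ k d n → (k + - d) + - (k + - n) ≡ - (d + - n)
      cancel = solve-∀
      swap : ∀ e f → - (e + - f) ≡ f + - e
      swap = solve-∀

  degree-⊖-resp : ∀ {A B C D} → (A ⊖ B) ∼ (C ⊖ D) → degree A - degree B ≡ degree C - degree D
  degree-⊖-resp {A} {B} {C} {D} A-B∼C-D =
    trans (sym (degree-⊖ A B)) (trans (E1 A-B∼C-D) (degree-⊖ C D))

  nonempty-resp : ∀ {A B} → A ∼ B → Nonempty A → Nonempty B
  nonempty-resp A∼B (H , H≥0 , H∼A) = H , H≥0 , ∼-trans H∼A A∼B

  effective⇒nonempty : ∀ E → Effective E → Nonempty E
  effective⇒nonempty E E≥0 = E , E≥0 , ∼-refl

  nonempty-⊕ : ∀ {A B} → Nonempty A → Nonempty B → Nonempty (A ⊕ B)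
  nonempty-⊕ (H , H≥0 , H∼A) (H′ , H′≥0 , H′∼B) =
    H ⊕ H′ , ⊕-effective {H} {H′} H≥0 H′≥0 , E2 H∼A H′∼B

  empty-⊖ : ∀ {A B} → Empty A → Nonempty B → Empty (A ⊖ B)
  empty-⊖ {A} {B} ∅ B≠∅ A-B≠∅ =
    ∅ (nonempty-resp (respects-≐ (λ x → cancel (coeff A x) (coeff B x)))
                     (nonempty-⊕ A-B≠∅ B≠∅))
    where
      cancel : ∀ a b → (a + - b) + b ≡ a
      cancel = solve-∀

  degree<0⇒empty : ∀ {D} → degree D < 0ℤ → Empty D
  degree<0⇒empty D<0 (H , H≥0 , H∼D) =
    ℤ.<⇒≱ D<0 (subst (0ℤ ≤_) (E1 H∼D) (degree-nonneg H H≥0))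

module Rank {a ℓ} {X : Set a} {_≟_ : DecidableEquality X}
  {_∼_ : Div X → Div X → Set ℓ} (isDivEquivalence : IsDivEquivalence _≟_ _∼_) where

  open Divisors _≟_
  open LinearSystems isDivEquivalence

  RankAtLeast : Div X → ℕ → Set (a ⊔ ℓ)
  RankAtLeast D s = ∀ E → Effective E → degree E ≡ + s → Nonempty (D ⊖ E)

  Rank : Div X → ℤ → Set (a ⊔ ℓ)
  Rank = IsRank _∼_ _≟_

  rankAtLeast-0⇔nonempty : ∀ {D} → RankAtLeast D 0 ⇔ Nonempty D
  rankAtLeast-0⇔nonempty {D} = mk⇔
    (λ D≥0 → nonempty-resp (respects-≐ (λ x → ℤ.+-identityʳ (coeff D x)))
                           (D≥0 0D (λ _ → ℤ.≤-refl) refl))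
    (λ D≠∅ E E≥0 degE≡0 → nonempty-resp
      (respects-≐ (λ x → minus-zero (effective-degree-0 E E≥0 degE≡0 x))) D≠∅)
    where
      minus-zero : ∀ {d e} → e ≡ 0ℤ → d ≡ d - e
      minus-zero {d} refl = sym (ℤ.+-identityʳ d)

  rank≥0⇔nonempty : ∀ {D r} → Rank D r → (0ℤ ≤ r) ⇔ Nonempty D
  rank≥0⇔nonempty (_ , r≥s⇔) = rankAtLeast-0⇔nonempty ⇔-∘ r≥s⇔ 0

  rank-of-empty : ∀ {D r} → Rank D r → Empty D → r ≡ -1ℤ
  rank-of-empty {r = + n}          R            ∅ =
    ⊥-elim (∅ (Equivalence.to (rank≥0⇔nonempty R) (+≤+ z≤n)))
  rank-of-empty {r = -[1+ 0 ]}     R            ∅ = refl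
  rank-of-empty {r = -[1+ suc n ]} (-≤- () , _) ∅

  rank<degree : ∀ {D r E} → Rank D r → Effective E → Empty (D ⊖ E) → r < degree E
  rank<degree {D} {r} {E} (_ , r≥s⇔) E≥0 ∅ = ℤ.≰⇒> λ degE≤r →
    ∅ (Equivalence.to (r≥s⇔ ∣ degree E ∣) (subst (_≤ r) (sym +∣degE∣≡degE) degE≤r)
                      E E≥0 (sym +∣degE∣≡degE))
    where
      +∣degE∣≡degE : + ∣ degree E ∣ ≡ degree E
      +∣degE∣≡degE = ℤ.0≤i⇒+∣i∣≡i (degree-nonneg E E≥0)

  rank<degree-of-positive-part : ∀ {D r ν E F} → Rank D r → Empty ν →
                                 Effective E → Effective F → (D ⊖ ν) ∼ (E ⊖ F) → r < degree E
  rank<degree-of-positive-part {D} {r} {ν} {E} {F} R ∅ E≥0 F≥0 D-ν∼E-F =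
    rank<degree {D} {E = E} R E≥0 λ D-E≠∅ →
      ∅ (nonempty-resp D-E+F∼ν (nonempty-⊕ D-E≠∅ (effective⇒nonempty F F≥0)))
    where
      open SetoidReasoning ∼-setoid
      D-E+F∼ν : ((D ⊖ E) ⊕ F) ∼ ν
      D-E+F∼ν = begin
        (D ⊖ E) ⊕ F      ≈⟨ respects-≐ (λ x → regroup (coeff D x) (coeff E x) (coeff F x)) ⟩
        D ⊖ (E ⊖ F)      ≈⟨ ⊖-congʳ D (∼-sym D-ν∼E-F) ⟩
        D ⊖ (D ⊖ ν)      ≈⟨ respects-≐ (λ x → cancel (coeff D x) (coeff ν x)) ⟩
        ν                ∎
        where
          regroup : ∀ d e f → (d + - e) + f ≡ d + - (e + - f)
          regroup = solve-∀
          cancel : ∀ d n → d + - (d + - n) ≡ n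
          cancel = solve-∀

module PointedRank {a ℓ} {X : Set a} {_≟_ : DecidableEquality X}
  {_∼_ : Div X → Div X → Set ℓ} (isDivEquivalence : IsDivEquivalence _≟_ _∼_) (x₀ : X) where

  open Divisors _≟_
  open LinearSystems isDivEquivalence
  open Rank isDivEquivalence

  rankAtLeast-pred : ∀ D {s} → RankAtLeast D (suc s) → RankAtLeast D s
  rankAtLeast-pred D {s} D≥s+1 E E≥0 degE≡s =
    nonempty-resp (respects-≐ (λ x → cancel (coeff D x) (coeff P x) (coeff E x)))
      (nonempty-⊕ (D≥s+1 (P ⊕ E) (⊕-effective {P} {E} P≥0 E≥0) degP+E≡s+1)
                  (effective⇒nonempty P P≥0))
    where
      P : Div X
      P = 1 ·⟨ x₀ ⟩
      P≥0 : Effective P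
      P≥0 = ·⟨⟩-effective 1 x₀
      degP+E≡s+1 : degree (P ⊕ E) ≡ + suc s
      degP+E≡s+1 = trans (degree-⊕ P E) (cong₂ _+_ (degree-·⟨⟩ 1 x₀) degE≡s)
      cancel : ∀ d p e → (d + - (p + e)) + p ≡ d + - e
      cancel = solve-∀

  rankAtLeast-≤ : ∀ D {s t} → s ℕ.≤ t → RankAtLeast D t → RankAtLeast D s
  rankAtLeast-≤ D s≤t = go (ℕ.≤⇒≤′ s≤t)
    where
      go : ∀ {s t} → s ℕ.≤′ t → RankAtLeast D t → RankAtLeast D s
      go ℕ.≤′-refl        = id
      go (ℕ.≤′-step s≤′t) = go s≤′t ∘ rankAtLeast-pred D

  rankAtLeast⇒≤degree : ∀ D {s} → RankAtLeast D s → + s ≤ degree D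
  rankAtLeast⇒≤degree D {s} D≥s with D≥s (s ·⟨ x₀ ⟩) (·⟨⟩-effective s x₀) (degree-·⟨⟩ s x₀)
  ... | H , H≥0 , H∼D-sx₀ = ℤ.0≤i-j⇒j≤i (begin
    0ℤ                             ≤⟨ degree-nonneg H H≥0 ⟩
    degree H                       ≡⟨ E1 H∼D-sx₀ ⟩
    degree (D ⊖ s ·⟨ x₀ ⟩)         ≡⟨ degree-⊖ D (s ·⟨ x₀ ⟩) ⟩
    degree D - degree (s ·⟨ x₀ ⟩)  ≡⟨ cong (_-_ (degree D)) (degree-·⟨⟩ s x₀) ⟩
    degree D - + s                 ∎)
    where open ℤ.≤-Reasoning

  least-failure⇒rank : ∀ D {s₀} → ¬ RankAtLeast D s₀ → (∀ {s} → s ℕ.< s₀ → RankAtLeast D s) →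
                       Rank D (pred (+ s₀))
  least-failure⇒rank D {s₀} ¬D≥s₀ D≥below = ℤ.i<j⇒i≤pred[j] {j = + s₀} -<+ , λ s → mk⇔
    (λ s≤r → D≥below (ℤ.drop‿+<+ (ℤ.i≤pred[j]⇒i<j s≤r)))
    (λ D≥s → ℤ.i<j⇒i≤pred[j] (+<+ (ℕ.≰⇒> (¬D≥s₀ ∘ λ s₀≤s → rankAtLeast-≤ D s₀≤s D≥s))))

module ClassicalRank {a ℓ} {X : Set a} {_≟_ : DecidableEquality X}
  {_∼_ : Div X → Div X → Set ℓ} (isDivEquivalence : IsDivEquivalence _≟_ _∼_)
  (x₀ : X) (em : ExcludedMiddle (a ⊔ ℓ)) where

  open Divisors _≟_
  open LinearSystems isDivEquivalence
  open Rank isDivEquivalence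
  open PointedRank isDivEquivalence x₀

  least-failure : ∀ D n → ¬ RankAtLeast D n →
                  ∃ λ s₀ → ¬ RankAtLeast D s₀ × (∀ {s} → s ℕ.< s₀ → RankAtLeast D s)
  least-failure D zero    ¬D≥0   = 0 , ¬D≥0 , λ ()
  least-failure D (suc n) ¬D≥n+1 with em {RankAtLeast D n}
  ... | yes D≥n = suc n , ¬D≥n+1 , λ s<n+1 → rankAtLeast-≤ D (ℕ.≤-pred s<n+1) D≥n
  ... | no ¬D≥n = least-failure D n ¬D≥n

  -- Opaque: only the types of these are used, and unfolding the search through
  -- excluded middle makes later `with`-abstractions prohibitively slow.
  opaque
    rank-exists : ∀ D → ∃ (Rank D)
    rank-exists D =
      let s₀ , ¬D≥s₀ , D≥below = least-failure D (suc ∣ degree D ∣) D≱suc∣degD∣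
      in  pred (+ s₀) , least-failure⇒rank D ¬D≥s₀ D≥below
      where
        D≱suc∣degD∣ : ¬ RankAtLeast D (suc ∣ degree D ∣)
        D≱suc∣degD∣ = ℤ.<⇒≱ (i<+suc∣i∣ (degree D)) ∘ rankAtLeast⇒≤degree D
          where
            i<+suc∣i∣ : ∀ i → i < + suc ∣ i ∣
            i<+suc∣i∣ (+ n)    = +<+ (ℕ.n<1+n n)
            i<+suc∣i∣ -[1+ n ] = -<+

    failure-witness : ∀ D {s} → ¬ RankAtLeast D s →
                      ∃ λ E → Effective E × degree E ≡ + s × Empty (D ⊖ E)
    failure-witness D ¬D≥s = decidable-stable em λ ∄E →
      ¬D≥s λ E E≥0 degE≡s → decidable-stable em λ ∅ → ∄E (E , E≥0 , degE≡s , ∅)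

    rank-obstruction : ∀ D {r} → Rank D r →
                       ∃ λ E → Effective E × degree E ≡ sucℤ r × Empty (D ⊖ E)
    rank-obstruction D {r} (r≥-1 , r≥s⇔) =
      let E , E≥0 , degE , ∅ = failure-witness D ¬D≥r+1
      in  E , E≥0 , trans degE +∣r+1∣≡r+1 , ∅
      where
        +∣r+1∣≡r+1 : + ∣ sucℤ r ∣ ≡ sucℤ r
        +∣r+1∣≡r+1 = ℤ.0≤i⇒+∣i∣≡i (ℤ.+-monoʳ-≤ 1ℤ r≥-1)
        ¬D≥r+1 : ¬ RankAtLeast D ∣ sucℤ r ∣
        ¬D≥r+1 D≥r+1 =
          ℤ.i≮i (ℤ.suc[i]≤j⇒i<j (subst (_≤ r) +∣r+1∣≡r+1 (Equivalence.from (r≥s⇔ _) D≥r+1)))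

module EmptinessIndicator {a ℓ} {X : Set a} {_≟_ : DecidableEquality X}
  {_∼_ : Div X → Div X → Set ℓ} (isDivEquivalence : IsDivEquivalence _≟_ _∼_)
  (em : ExcludedMiddle (a ⊔ ℓ)) where

  open LinearSystems isDivEquivalence

  nonempty-or-empty : ∀ D → Nonempty D ⊎ Empty D
  nonempty-or-empty D with em {Nonempty D}
  ... | yes D≠∅ = inj₁ D≠∅
  ... | no ∅    = inj₂ ∅

  ε-nonempty : ∀ {D} → Nonempty D → ε _∼_ em D ≡ false
  ε-nonempty {D} D≠∅ with em {Nonempty D}
  ... | yes _ = refl
  ... | no ∅  = contradiction D≠∅ ∅

  ε-empty : ∀ {D} → Empty D → ε _∼_ em D ≡ true
  ε-empty {D} ∅ with em {Nonempty D}
  ... | yes D≠∅ = contradiction D≠∅ ∅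
  ... | no _    = refl

  ε≡false⇒nonempty : ∀ {D} → ε _∼_ em D ≡ false → Nonempty D
  ε≡false⇒nonempty {D} with em {Nonempty D}
  ... | yes D≠∅ = λ _ → D≠∅
  ... | no _    = λ ()

  ε≡true⇒empty : ∀ {D} → ε _∼_ em D ≡ true → Empty D
  ε≡true⇒empty ε≡true D≠∅ with () ← trans (sym ε≡true) (ε-nonempty D≠∅)

  ε-cong : ∀ {A B} → Nonempty A ⇔ Nonempty B → ε _∼_ em A ≡ ε _∼_ em B
  ε-cong {A} {B} A⇔B with em {Nonempty B}
  ... | yes B≠∅ = ε-nonempty (Equivalence.from A⇔B B≠∅)
  ... | no ∅    = ε-empty (∅ ∘ Equivalence.to A⇔B)

  ε-xor-empty : ∀ {A B b} → Empty A → (ε _∼_ em A xor ε _∼_ em B) ≡ b → ε _∼_ em B ≡ not b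
  ε-xor-empty {A} {B} {b} ∅ xor≡b = not-injective (begin
    not (ε _∼_ em B)           ≡⟨ cong (_xor (ε _∼_ em B)) (ε-empty ∅) ⟨
    ε _∼_ em A xor ε _∼_ em B  ≡⟨ xor≡b ⟩
    b                          ≡⟨ not-involutive b ⟨
    not (not b)                ∎)
    where open ≡-Reasoning

module RiemannRoch {a ℓ} {X : Set a} {_≟_ : DecidableEquality X}
  {_∼_ : Div X → Div X → Set ℓ} (isDivEquivalence : IsDivEquivalence _≟_ _∼_)
  (x₀ : X) (em : ExcludedMiddle (a ⊔ ℓ)) (g : ℕ) (K : Div X) where

  open Divisors _≟_
  open LinearSystems isDivEquivalence
  open Rank isDivEquivalence
  open ClassicalRank isDivEquivalence x₀ em
  open EmptinessIndicator isDivEquivalence em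

  In𝒩 : Div X → Set (a ⊔ ℓ)
  In𝒩 = InN _∼_ _≟_ g

  RiemannRochFormula : Set (a ⊔ ℓ)
  RiemannRochFormula =
    ∀ D r₁ r₂ → Rank D r₁ → Rank (K ⊖ D) r₂ → r₁ - r₂ ≡ degree D + 1ℤ - + g

  RR1 : Set (a ⊔ ℓ)
  RR1 = ∀ D → ∃ λ ν → In𝒩 ν × (ε _∼_ em D xor ε _∼_ em (ν ⊖ D)) ≡ true

  RR2 : Set a
  RR2 = ∀ D → degree D ≡ + g - 1ℤ → (ε _∼_ em D xor ε _∼_ em (K ⊖ D)) ≡ false

  negative-point-empty : Empty (⊝ 1 ·⟨ x₀ ⟩)
  negative-point-empty = degree<0⇒empty (subst (_< 0ℤ) (sym degree≡-1) -<+)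
    where
      degree≡-1 : degree (⊝ 1 ·⟨ x₀ ⟩) ≡ -1ℤ
      degree≡-1 = trans (degree-⊝ (1 ·⟨ x₀ ⟩)) (cong -_ (degree-·⟨⟩ 1 x₀))

  module _ (riemann-roch : RiemannRochFormula) where

    rank-self-dual : ∀ D {r₁ r₂} → degree D ≡ + g - 1ℤ →
                     Rank D r₁ → Rank (K ⊖ D) r₂ → r₁ ≡ r₂
    rank-self-dual D {r₁} {r₂} degD R₁ R₂ = ℤ.i-j≡0⇒i≡j r₁ r₂ (begin
      r₁ - r₂                ≡⟨ riemann-roch D r₁ r₂ R₁ R₂ ⟩
      degree D + 1ℤ - + g    ≡⟨ cong (λ d → d + 1ℤ - + g) degD ⟩
      + g - 1ℤ + 1ℤ - + g    ≡⟨ cancel (+ g) ⟩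
      0ℤ                     ∎)
      where
        open ≡-Reasoning
        cancel : ∀ G → G - 1ℤ + 1ℤ - G ≡ 0ℤ
        cancel = solve-∀

    nonempty⇔nonempty-dual : ∀ D → degree D ≡ + g - 1ℤ → Nonempty D ⇔ Nonempty (K ⊖ D)
    nonempty⇔nonempty-dual D degD with rank-exists D | rank-exists (K ⊖ D)
    ... | r₁ , R₁ | r₂ , R₂ with rank-self-dual D degD R₁ R₂
    ... | refl = rank≥0⇔nonempty R₂ ⇔-∘ ⇔-sym (rank≥0⇔nonempty R₁)

    degree+dual-rank : ∀ D {r} → Empty D → Rank (K ⊖ D) r → degree D + sucℤ r ≡ + g - 1ℤ
    degree+dual-rank D {r} ∅ R with rank-exists D
    ... | r₁ , R₁ = ℤ.i-j≡0⇒i≡j _ _ (begin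
      degree D + sucℤ r - (+ g - 1ℤ)      ≡⟨ regroup (degree D) r (+ g) ⟩
      (degree D + 1ℤ - + g) - (-1ℤ - r)   ≡⟨ cong (_- (-1ℤ - r)) (riemann-roch D r₁ r R₁ R) ⟨
      (r₁ - r) - (-1ℤ - r)                ≡⟨ cong (λ r₁ → (r₁ - r) - (-1ℤ - r)) (rank-of-empty R₁ ∅) ⟩
      (-1ℤ - r) - (-1ℤ - r)               ≡⟨ ℤ.+-inverseʳ (-1ℤ - r) ⟩
      0ℤ                                  ∎)
      where
        open ≡-Reasoning
        regroup : ∀ d r G → d + (1ℤ + r) - (G - 1ℤ) ≡ (d + 1ℤ - G) - (-1ℤ - r)
        regroup = solve-∀

    empty⇒below-𝒩 : ∀ D → Empty D → ∃ λ ν → In𝒩 ν × Nonempty (ν ⊖ D)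
    empty⇒below-𝒩 D ∅ with rank-exists (K ⊖ D)
    ... | r , R with rank-obstruction (K ⊖ D) R
    ... | E , E≥0 , degE , K-D-E-empty =
      D ⊕ E , (degD+E , D+E-empty) , nonempty-resp E∼D+E-D (effective⇒nonempty E E≥0)
      where
        degD+E : degree (D ⊕ E) ≡ + g - 1ℤ
        degD+E = trans (degree-⊕ D E) (trans (cong (_+_ (degree D)) degE) (degree+dual-rank D ∅ R))
        D+E-empty : Empty (D ⊕ E)
        D+E-empty = K-D-E-empty
                  ∘ nonempty-resp (respects-≐ (λ x → distrib (coeff K x) (coeff D x) (coeff E x)))
                  ∘ Equivalence.to (nonempty⇔nonempty-dual (D ⊕ E) degD+E)
          where
            distrib : ∀ k d e → k - (d + e) ≡ (k - d) - e
            distrib = solve-∀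
        E∼D+E-D : E ∼ ((D ⊕ E) ⊖ D)
        E∼D+E-D = respects-≐ (λ x → add-sub (coeff D x) (coeff E x))
          where
            add-sub : ∀ d e → e ≡ (d + e) - d
            add-sub = solve-∀

    𝒩-inhabited : ∃ In𝒩
    𝒩-inhabited = proj₁ below , proj₁ (proj₂ below)
      where
        below : ∃ λ ν → In𝒩 ν × Nonempty (ν ⊖ (⊝ 1 ·⟨ x₀ ⟩))
        below = empty⇒below-𝒩 (⊝ 1 ·⟨ x₀ ⟩) negative-point-empty

    riemann-roch⇒RR1 : RR1
    riemann-roch⇒RR1 D with nonempty-or-empty D
    ... | inj₁ D≠∅ = let ν , ν∈𝒩 = 𝒩-inhabited in
      ν , ν∈𝒩 , cong₂ _xor_ (ε-nonempty D≠∅) (ε-empty (empty-⊖ (proj₂ ν∈𝒩) D≠∅))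
    ... | inj₂ ∅    = let ν , ν∈𝒩 , ν-D≠∅ = empty⇒below-𝒩 D ∅ in
      ν , ν∈𝒩 , cong₂ _xor_ (ε-empty ∅) (ε-nonempty ν-D≠∅)

    riemann-roch⇒RR2 : RR2
    riemann-roch⇒RR2 D degD = trans (cong (_xor_ (ε _∼_ em D)) ε-dual≡ε) (xor-same (ε _∼_ em D))
      where
        ε-dual≡ε : ε _∼_ em (K ⊖ D) ≡ ε _∼_ em D
        ε-dual≡ε = sym (ε-cong (nonempty⇔nonempty-dual D degD))

  record 𝒩-Decomposition (D : Div X) (r : ℤ) : Set (a ⊔ ℓ) where
    field
      ν E F    : Div X
      ν∈𝒩      : In𝒩 ν
      E≥0      : Effective E
      F≥0      : Effective F
      D-ν∼E-F  : (D ⊖ ν) ∼ (E ⊖ F)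
      degree-E : degree E ≡ sucℤ r

  module _ (rr1 : RR1) (rr2 : RR2) where

    dual-of-𝒩-empty : ∀ {ν} → In𝒩 ν → Empty (K ⊖ ν)
    dual-of-𝒩-empty {ν} (degν , ∅) = ε≡true⇒empty (ε-xor-empty ∅ (rr2 ν degν))

    decompose : ∀ D {r} → Rank D r → 𝒩-Decomposition D r
    decompose D R with rank-obstruction D R
    ... | E , E≥0 , degE , ∅ with rr1 (D ⊖ E)
    ... | ν , ν∈𝒩 , xor≡true with ε≡false⇒nonempty (ε-xor-empty ∅ xor≡true)
    ... | F , F≥0 , F∼ν-[D-E] = record
      { ν = ν ; E = E ; F = F ; ν∈𝒩 = ν∈𝒩 ; E≥0 = E≥0 ; F≥0 = F≥0 ; degree-E = degE
      ; D-ν∼E-F = begin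
          D ⊖ ν               ≈⟨ respects-≐ (λ x → regroup (coeff D x) (coeff ν x) (coeff E x)) ⟩
          E ⊖ (ν ⊖ (D ⊖ E))   ≈⟨ ⊖-congʳ E (∼-sym F∼ν-[D-E]) ⟩
          E ⊖ F               ∎
      }
      where
        open SetoidReasoning ∼-setoid
        regroup : ∀ d n e → d - n ≡ e - (n - (d - e))
        regroup = solve-∀

    riemann-roch-≥ : ∀ D D′ {r r′} → D′ ∼ (K ⊖ D) → Rank D r → Rank D′ r′ →
                     degree D + 1ℤ - + g ≤ r - r′
    riemann-roch-≥ D D′ {r} {r′} D′∼K-D R R′ = begin
      degree D + 1ℤ - + g          ≡⟨ shift (degree D) (+ g) ⟩
      degree D - (+ g - 1ℤ)        ≡⟨ cong (_-_ (degree D)) (proj₁ ν∈𝒩) ⟨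
      degree D - degree ν          ≡⟨ degree-⊖-resp {D} {ν} {E} {F} D-ν∼E-F ⟩
      degree E - degree F          ≡⟨ cong (λ e → e - degree F) degree-E ⟩
      sucℤ r - degree F            ≤⟨ ℤ.+-monoʳ-≤ (sucℤ r) (ℤ.neg-mono-≤ (ℤ.i<j⇒suc[i]≤j r′<degF)) ⟩
      sucℤ r - sucℤ r′             ≡⟨ cancel r r′ ⟩
      r - r′                       ∎
      where
        open 𝒩-Decomposition (decompose D R)
        open ℤ.≤-Reasoning
        r′<degF : r′ < degree F
        r′<degF = rank<degree-of-positive-part {D′} {ν = K ⊖ ν} {F} {E}
                    R′ (dual-of-𝒩-empty ν∈𝒩) F≥0 E≥0 (⊖-dual K {D} {D′} {ν} {E} {F} D′∼K-D D-ν∼E-F)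
        shift : ∀ d G → d + 1ℤ - G ≡ d - (G - 1ℤ)
        shift = solve-∀
        cancel : ∀ r r′ → (1ℤ + r) - (1ℤ + r′) ≡ r - r′
        cancel = solve-∀

    riemann-roch-≤ : degree K ≡ + (2 * g) - + 2 →
                     ∀ D {r r′} → Rank D r → Rank (K ⊖ D) r′ → r - r′ ≤ degree D + 1ℤ - + g
    riemann-roch-≤ degK D {r} {r′} R R′ = begin
      r - r′                                         ≡⟨ flip r r′ ⟩
      - (r′ - r)                                     ≤⟨ ℤ.neg-mono-≤ dual-bound ⟩
      - (degree (K ⊖ D) + 1ℤ - + g)                  ≡⟨ cong (λ e → - (e + 1ℤ - + g)) degK-D ⟩
      - (+ 2 ℤ.* + g - + 2 - degree D + 1ℤ - + g)    ≡⟨ reflect (degree D) (+ g) ⟩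
      degree D + 1ℤ - + g                            ∎
      where
        open ℤ.≤-Reasoning
        D∼K-[K-D] : D ∼ (K ⊖ (K ⊖ D))
        D∼K-[K-D] = respects-≐ (λ x → cancel (coeff K x) (coeff D x))
          where
            cancel : ∀ k d → d ≡ k - (k - d)
            cancel = solve-∀
        dual-bound : degree (K ⊖ D) + 1ℤ - + g ≤ r′ - r
        dual-bound = riemann-roch-≥ (K ⊖ D) D D∼K-[K-D] R′ R
        degK-D : degree (K ⊖ D) ≡ + 2 ℤ.* + g - + 2 - degree D
        degK-D =
          trans (degree-⊖ K D) (cong (_- degree D) (trans degK (cong (_- + 2) (ℤ.pos-* 2 g))))
        flip : ∀ i j → i - j ≡ - (j - i)
        flip = solve-∀
        reflect : ∀ d G → - (+ 2 ℤ.* G - + 2 - d + 1ℤ - G) ≡ d + 1ℤ - G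
        reflect = solve-∀

    RR⇒riemann-roch : degree K ≡ + (2 * g) - + 2 → RiemannRochFormula
    RR⇒riemann-roch degK D r₁ r₂ R₁ R₂ =
      ℤ.≤-antisym (riemann-roch-≤ degK D R₁ R₂) (riemann-roch-≥ D (K ⊖ D) ∼-refl R₁ R₂)

theorem2p2 : ∀ {a ℓ : Level} {X : Set a} (_≟_ : DecidableEquality X) (x₀ : X)
    (_∼_ : Div X → Div X → Set ℓ) → IsDivEquivalence _≟_ _∼_ →
    (em : ExcludedMiddle (a ⊔ ℓ)) →
    (g : ℕ) (K : Div X) → deg _≟_ K ≡ + (2 * g) - + 2 →
    ((∀ (D : Div X) (r₁ r₂ : ℤ) → IsRank _∼_ _≟_ D r₁ → IsRank _∼_ _≟_ (K ⊖ D) r₂ →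
        r₁ - r₂ ≡ deg _≟_ D + + 1 - + g)
     ⇔
     ((∀ (D : Div X) → ∃ λ ν → InN _∼_ _≟_ g ν × (ε _∼_ em D xor ε _∼_ em (ν ⊖ D)) ≡ true)
      ×
      (∀ (D : Div X) → deg _≟_ D ≡ + g - + 1 → (ε _∼_ em D xor ε _∼_ em (K ⊖ D)) ≡ false)))
theorem2p2 _≟_ x₀ _∼_ isDivEquivalence em g K degK =
  mk⇔ (λ riemann-roch → riemann-roch⇒RR1 riemann-roch , riemann-roch⇒RR2 riemann-roch)
      (λ (rr1 , rr2) → RR⇒riemann-roch rr1 rr2 degK)
  where open RiemannRoch isDivEquivalence x₀ em g K
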